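{- For a permutation $\pi=(\pi(1),\ldots,\pi(m))$ of $\{1,\ldots,m\}$ write $\Phi_{\mathrm{product}}(\pi)=\sum_{k=1}^{m-1}\frac{1}{\pi(k)\pi(k+1)}$. Let $n\geq 3$, let $\sigma=(\sigma(1),\ldots,\sigma(n-1))$ be a permutation of $\{1,\ldots,n-1\}$, let $j\in\{1,2,\ldots,n-2\}$, and let $\tau$ be the permutation of $\{1,\ldots,n\}$ obtained by inserting the letter $n$ into $\sigma$ between positions $j$ and $j+1$: $$\tau=(\sigma(1),\ldots,\sigma(j),\,n,\,\sigma(j+1),\ldots,\sigma(n-1)).$$ Then $\Phi_{\mathrm{product}}(\sigma)=\Phi_{\mathrm{product}}(\tau)$ if and only if $\sigma(j)+\sigma(j+1)=n$. -}

module Defs where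

open import Data.Nat using (ℕ; zero; suc; _*_)
open import Data.List using (List; []; _∷_; map; upTo)
open import Data.Integer using (+_)
open import Data.Rational using (ℚ; 0ℚ; _/_; _+_)

-- 1/k as a rational; the value at 0 is an arbitrary convention (never used on
-- permutations of {1,…,m}, whose entries are all ≥ 1).
recip : ℕ → ℚ
recip zero    = 0ℚ
recip (suc k) = (+ 1) / suc k

Φproduct : List ℕ → ℚ
Φproduct (a ∷ b ∷ rest) = recip (a * b) + Φproduct (b ∷ rest)
Φproduct _              = 0ℚ

oneTo : ℕ → List ℕ
oneTo m = map suc (upTo m)

-- 1-indexed entry π(i) of a sequence (default 0 out of range)
at : List ℕ → ℕ → ℕ
at []       _             = 0
at (x ∷ xs) zero          = 0
at (x ∷ xs) (suc zero)    = x
at (x ∷ xs) (suc (suc i)) = at xs (suc i)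

-- Inserting x between adjacent entries a, b of a sequence replaces the summand
-- 1/(ab) of Φ_product by 1/(ax) + 1/(xb) and leaves all other summands alone,
-- so Φ_product is preserved iff 1/(ab) = 1/(ax) + 1/(xb).  Clearing
-- denominators, this says abx·x = abx·(a + b), i.e. x = a + b.
module Submission where

open import Defs
open import Data.Nat using (ℕ; _≤_; _+_; _∸_)
open import Data.List using (List; _∷_; _++_; take; drop)
open import Data.List.Relation.Binary.Permutation.Propositional using (_↭_; ↭-sym)
open import Data.Rational using (ℚ)
open import Relation.Binary.PropositionalEquality using (_≡_)
open import Function.Bundles using (_⇔_)

open import Data.Nat using (suc; zero; _*_; s≤s; z≤n; _<_; NonZero)
import Data.Nat.Properties as ℕ
open import Data.Nat.Tactic.RingSolver using (solve-∀)
open import Data.List using ([]; length; upTo)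
open import Data.List.Properties using (length-map; length-upTo)
open import Data.List.Relation.Unary.All using (All; _∷_; universal)
open import Data.List.Relation.Unary.All.Properties using (map⁺)
open import Data.List.Relation.Binary.Permutation.Propositional.Properties using (All-resp-↭; ↭-length)
open import Data.Integer using (+_)
open import Data.Integer.Properties using (+-injective)
import Data.Rational as ℚ
open import Data.Rational.Properties using (+-assoc; +-0-group; toℚᵘ-fromℚᵘ; toℚᵘ-cong; toℚᵘ-injective; toℚᵘ-homo-+)
open import Data.Rational.Unnormalised using (mkℚᵘ; *≡*) renaming (_≃_ to _≃ᵘ_; _+_ to _+ᵘ_)
open import Data.Rational.Unnormalised.Properties using (≃-trans; ≃-sym; +-cong)
open import Algebra.Properties.Group +-0-group using (∙-cancelˡ; ∙-cancelʳ)
open import Relation.Binary.PropositionalEquality using (sym; trans; cong; subst)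
open import Function.Bundles using (mk⇔)
import Function.Properties.Equivalence as ⇔

+-cancelˡ⇔ : ∀ (x y z : ℚ) → (x ℚ.+ y ≡ x ℚ.+ z) ⇔ (y ≡ z)
+-cancelˡ⇔ x y z = mk⇔ (∙-cancelˡ x y z) (cong (x ℚ.+_))

+-cancelʳ⇔ : ∀ (x y z : ℚ) → (y ℚ.+ x ≡ z ℚ.+ x) ⇔ (y ≡ z)
+-cancelʳ⇔ x y z = mk⇔ (∙-cancelʳ x y z) (cong (ℚ._+ x))

recip-suc≃ : ∀ k → ℚ.toℚᵘ (recip (suc k)) ≃ᵘ mkℚᵘ (+ 1) k
recip-suc≃ k = toℚᵘ-fromℚᵘ (mkℚᵘ (+ 1) k)

recip≡recip+recip⇔ : ∀ p q r →
  (recip (suc p) ≡ recip (suc q) ℚ.+ recip (suc r)) ⇔ (suc q * suc r ≡ suc p * (suc q + suc r))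
recip≡recip+recip⇔ p q r = mk⇔
  (λ eq → cross-multiplied (≃-trans (≃-sym (recip-suc≃ p)) (≃-trans (toℚᵘ-cong eq) sum≃)))
  (λ eq → toℚᵘ-injective (≃-trans (recip-suc≃ p)
            (≃-trans (*≡* (cong +_ (trans lhs≡ (trans eq (sym rhs≡))))) (≃-sym sum≃))))
  where
  P Q R : ℕ
  P = suc p ; Q = suc q ; R = suc r
  sum≃ : ℚ.toℚᵘ (recip Q ℚ.+ recip R) ≃ᵘ mkℚᵘ (+ 1) q +ᵘ mkℚᵘ (+ 1) r
  sum≃ = ≃-trans (toℚᵘ-homo-+ (recip Q) (recip R)) (+-cong (recip-suc≃ q) (recip-suc≃ r))
  lhs≡ : 1 * (Q * R) ≡ Q * R
  lhs≡ = ℕ.*-identityˡ (Q * R)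
  rhs≡ : (1 * R + 1 * Q) * P ≡ P * (Q + R)
  rhs≡ = cross R Q P
    where
    cross : ∀ z y x → (1 * z + 1 * y) * x ≡ x * (y + z)
    cross = solve-∀
  cross-multiplied : mkℚᵘ (+ 1) p ≃ᵘ mkℚᵘ (+ 1) q +ᵘ mkℚᵘ (+ 1) r → Q * R ≡ P * (Q + R)
  cross-multiplied (*≡* eq) = trans (sym lhs≡) (trans (+-injective eq) rhs≡)

a*n*[n*b]≡a*b*[a*n+n*b]⇔a+b≡n : ∀ a b n .{{_ : NonZero a}} .{{_ : NonZero b}} .{{_ : NonZero n}} →
  (a * n * (n * b) ≡ a * b * (a * n + n * b)) ⇔ (a + b ≡ n)
a*n*[n*b]≡a*b*[a*n+n*b]⇔a+b≡n a b n = mk⇔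
  (λ eq → sym (ℕ.*-cancelˡ-≡ n (a + b) (a * b * n) (trans (sym lhs≡) (trans eq rhs≡))))
  (λ eq → trans lhs≡ (trans (cong (a * b * n *_) (sym eq)) (sym rhs≡)))
  where
  instance
    abn≢0 : NonZero (a * b * n)
    abn≢0 = ℕ.m*n≢0 (a * b) n {{ℕ.m*n≢0 a b}}
  lhs≡ : a * n * (n * b) ≡ a * b * n * n
  lhs≡ = identity a b n
    where
    identity : ∀ x y z → x * z * (z * y) ≡ x * y * z * z
    identity = solve-∀
  rhs≡ : a * b * (a * n + n * b) ≡ a * b * n * (a + b)
  rhs≡ = identity a b n
    where
    identity : ∀ x y z → x * y * (x * z + z * y) ≡ x * y * z * (x + y)
    identity = solve-∀

recip[a*b]≡recip[a*n]+recip[n*b]⇔a+b≡n : ∀ {a b n} → 1 ≤ a → 1 ≤ b → 1 ≤ n →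
  (recip (a * b) ≡ recip (a * n) ℚ.+ recip (n * b)) ⇔ (a + b ≡ n)
recip[a*b]≡recip[a*n]+recip[n*b]⇔a+b≡n {suc a} {suc b} {suc n} (s≤s z≤n) (s≤s z≤n) (s≤s z≤n) =
  ⇔.trans (recip≡recip+recip⇔ (b + a * suc b) (n + a * suc n) (b + n * suc b))
          (a*n*[n*b]≡a*b*[a*n+n*b]⇔a+b≡n (suc a) (suc b) (suc n))

Φproduct-insert⇔ : ∀ x xs j → 1 ≤ j → j < length xs →
  (Φproduct xs ≡ Φproduct (take j xs ++ x ∷ drop j xs))
  ⇔ (recip (at xs j * at xs (1 + j)) ≡ recip (at xs j * x) ℚ.+ recip (x * at xs (1 + j)))
Φproduct-insert⇔ x (a ∷ b ∷ ys) 1 _ _ =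
  subst (λ rhs → (recip (a * b) ℚ.+ tail ≡ rhs) ⇔ (recip (a * b) ≡ recip (a * x) ℚ.+ recip (x * b)))
        (+-assoc (recip (a * x)) (recip (x * b)) tail)
        (+-cancelʳ⇔ tail (recip (a * b)) (recip (a * x) ℚ.+ recip (x * b)))
  where
  tail : ℚ
  tail = Φproduct (b ∷ ys)
Φproduct-insert⇔ x (a ∷ b ∷ ys) (suc (suc i)) _ (s≤s i<) =
  ⇔.trans (+-cancelˡ⇔ (recip (a * b)) _ _) (Φproduct-insert⇔ x (b ∷ ys) (suc i) (s≤s z≤n) i<)
Φproduct-insert⇔ x (a ∷ []) (suc zero)    _ (s≤s ())
Φproduct-insert⇔ x (a ∷ []) (suc (suc i)) _ (s≤s ())

All-at : ∀ {P : ℕ → Set} {xs i} → All P xs → 1 ≤ i → i ≤ length xs → P (at xs i)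
All-at {i = suc zero}    (px ∷ _)   _ _         = px
All-at {i = suc (suc i)} (_  ∷ pxs) _ (s≤s i≤) = All-at pxs (s≤s z≤n) i≤

oneTo-positive : ∀ k → All (1 ≤_) (oneTo k)
oneTo-positive k = map⁺ (universal (λ _ → s≤s z≤n) (upTo k))

length-oneTo : ∀ k → length (oneTo k) ≡ k
length-oneTo k = trans (length-map suc (upTo k)) (length-upTo k)

lemma2 : (n : ℕ) → 3 ≤ n → (σ : List ℕ) → σ ↭ oneTo (n ∸ 1) →
         (j : ℕ) → 1 ≤ j → j ≤ n ∸ 2 →
         (Φproduct σ ≡ Φproduct (take j σ ++ n ∷ drop j σ)) ⇔ (at σ j + at σ (1 + j) ≡ n)
lemma2 n@(suc (suc (suc _))) _ σ σ↭ j 1≤j j≤n∸2 =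
  ⇔.trans (Φproduct-insert⇔ n σ j 1≤j j<length)
          (recip[a*b]≡recip[a*n]+recip[n*b]⇔a+b≡n
            (All-at positive 1≤j (ℕ.<⇒≤ j<length)) (All-at positive (s≤s z≤n) j<length) (s≤s z≤n))
  where
  positive : All (1 ≤_) σ
  positive = All-resp-↭ (↭-sym σ↭) (oneTo-positive (n ∸ 1))
  j<length : j < length σ
  j<length = subst (j <_) (sym (trans (↭-length σ↭) (length-oneTo (n ∸ 1)))) (s≤s j≤n∸2)
lemma2 1 (s≤s ()) _ _ _ _ _
lemma2 2 (s≤s (s≤s ())) _ _ _ _ _
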